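{- Let $G=G(A,B)$ be a finite bipartite graph with bipartition $(A,B)$ and $|A|\leqslant|B|$. Then $$mp_f(G)=\min\left\{\left.\frac{e(X,Y)}{|X|+|Y|-|A|}\ \right|\ X\subseteq A,\ Y\subseteq B,\ |X|+|Y|-|A|>0\right\}.$$ Furthermore, for every $X\subseteq A$ and $Y\subseteq B$ with $|X|+|Y|-|A|>0$ and $mp_f(G)=\frac{e(X,Y)}{|X|+|Y|-|A|}$, the vector $\widetilde{\bm{y}}\in\mathbb{R}^{E(G)}$ defined by $\widetilde{y}_e=\frac{1}{|X|+|Y|-|A|}$ if $e\in E(X,Y)$ and $\widetilde{y}_e=0$ otherwise is an optimal solution of (FMP).
   Context: $E(X,Y)$ denotes the set of edges with one end in $X$ and the other in $Y$, and $e(X,Y)=|E(X,Y)|$. Let $\mathcal{M}(G)$ be the set of perfect matchings of $G$ and $\bm{q}^M\in\mathbb{R}^{E(G)}$ the incidence vector of $M$. (FMP) is the linear program: minimize $\bm{1}^T\bm{y}$ over $\bm{y}\in\mathbb{R}^{E(G)}$ subject to $(\bm{q}^M)^T\bm{y}\geqslant 1$ for every $M\in\mathcal{M}(G)$ and $y_e\geqslant 0$ for every $e\in E(G)$; its optimal value is the fractional matching preclusion number $mp_f(G)$.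
   Formalization: The linear program (FMP) is taken over ℚ rather than ℝ, so its feasible vectors, its optimal solutions and the value $mp_f(G)$ are rational. -}

module Defs where

open import Data.Nat as ℕ using (ℕ; zero; suc; _<_; _∸_; >-nonZero)
open import Data.Nat.Properties using (m<n⇒0<n∸m)
open import Data.Integer using (+_)
open import Data.Rational using (ℚ; 0ℚ; 1ℚ; _+_; _≤_; _/_)
open import Data.Fin using (Fin; zero; suc)
open import Data.Fin.Subset using (Subset; _∈_; ∣_∣)
open import Data.Vec using (lookup)
open import Data.Bool using (Bool; true; false; if_then_else_; _∧_)
open import Data.Product using (Σ; ∃; ∃-syntax; _×_; _,_; proj₁; proj₂)
open import Relation.Binary.PropositionalEquality using (_≡_)

-- A finite simple bipartite graph with parts A = Fin a, B = Fin b.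
-- Its edges are indexed by Fin m; each edge e has end tail e ∈ A and
-- head e ∈ B; 'ends' is injective (no parallel edges).
record BipGraph (a b : ℕ) : Set where
  field
    m    : ℕ
    ends : Fin m → Fin a × Fin b
    simple : ∀ {e f} → ends e ≡ ends f → e ≡ f

  tail : Fin m → Fin a
  tail e = proj₁ (ends e)

  head : Fin m → Fin b
  head e = proj₂ (ends e)

open BipGraph public

ΣQ : (n : ℕ) → (Fin n → ℚ) → ℚ
ΣQ zero    f = 0ℚ
ΣQ (suc n) f = f zero + ΣQ n (λ i → f (suc i))

count : (n : ℕ) → (Fin n → Bool) → ℕ
count zero    p = 0
count (suc n) p = (if p zero then 1 else 0) ℕ.+ count n (λ i → p (suc i))

module _ {a b : ℕ} (G : BipGraph a b) where

  IsPerfectMatching : Subset (m G) → Set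
  IsPerfectMatching M =
    (∀ (i : Fin a) → Σ (Fin (m G)) λ e → (e ∈ M) × (tail G e ≡ i) ×
        (∀ f → f ∈ M → tail G f ≡ i → f ≡ e))
    × (∀ (j : Fin b) → Σ (Fin (m G)) λ e → (e ∈ M) × (head G e ≡ j) ×
        (∀ f → f ∈ M → head G f ≡ j → f ≡ e))

  matchWeight : Subset (m G) → (Fin (m G) → ℚ) → ℚ
  matchWeight M y = ΣQ (m G) (λ e → if lookup M e then y e else 0ℚ)

  total : (Fin (m G) → ℚ) → ℚ
  total y = ΣQ (m G) y

  Feasible : (Fin (m G) → ℚ) → Set
  Feasible y = (∀ M → IsPerfectMatching M → 1ℚ ≤ matchWeight M y)
             × (∀ e → 0ℚ ≤ y e)

  IsOptimalSolution : (Fin (m G) → ℚ) → Set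
  IsOptimalSolution y = Feasible y × (∀ z → Feasible z → total y ≤ total z)

  IsMpf : ℚ → Set
  IsMpf v = Σ (Fin (m G) → ℚ) λ y → IsOptimalSolution y × total y ≡ v

  eXY : Subset a → Subset b → ℕ
  eXY X Y = count (m G) (λ e → lookup X (tail G e) ∧ lookup Y (head G e))

  -- |X| + |Y| - |A|  (used only when positive)
  den : Subset a → Subset b → ℕ
  den X Y = (∣ X ∣ ℕ.+ ∣ Y ∣) ∸ a

  ratio : (X : Subset a) (Y : Subset b) → a < ∣ X ∣ ℕ.+ ∣ Y ∣ → ℚ
  ratio X Y p = ((+ eXY X Y) / den X Y) {{>-nonZero (m<n⇒0<n∸m p)}}

  IsMinRatio : ℚ → Set
  IsMinRatio v =
    (∃[ X ] ∃[ Y ] Σ (a < ∣ X ∣ ℕ.+ ∣ Y ∣) λ p → v ≡ ratio X Y p)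
    × (∀ X Y (p : a < ∣ X ∣ ℕ.+ ∣ Y ∣) → v ≤ ratio X Y p)

  ytilde : (X : Subset a) (Y : Subset b) → a < ∣ X ∣ ℕ.+ ∣ Y ∣ → Fin (m G) → ℚ
  ytilde X Y p e =
    if lookup X (tail G e) ∧ lookup Y (head G e)
    then ((+ 1) / den X Y) {{>-nonZero (m<n⇒0<n∸m p)}}
    else 0ℚ

-- Write d(X,Y) = |X| + |Y| − |A|.  A perfect matching covers every vertex exactly once, so at
-- least d(X,Y) of its edges go from X to Y; hence ỹ is feasible, and its cost is e(X,Y)/d(X,Y).
-- Conversely, let p/q be the least ratio.  Then p·d(X,Y) ≤ q·e(X,Y) for all X and Y (and
-- |A| = |B| once p > 0), which is Gale's supply–demand condition for supply and demand p at
-- every vertex and capacity q on every edge.  Gale's theorem yields a p-regular multigraph on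
-- the edges of G using every edge at most q times; a regular bipartite multigraph splits into
-- perfect matchings, so every feasible y satisfies p ≤ ∑ₑ f(e)·y(e) ≤ q·1ᵀy.
--
-- Gale's theorem itself is proved by removing units of capacity while the condition
-- s(X) + t(Y) ≤ c(X,Y) + s(A) survives.  When no unit can be removed, every edge of positive
-- capacity lies in a tight pair (X, Y); tight pairs are closed under (X ∩ X′, Y ∪ Y′) because
-- c(X,Y) is submodular, and a tight pair containing a vertex i and all its neighbours forces
-- the capacity at i to equal the supply at i.

module Submission where

open import Algebra.Bundles using (CommutativeRing)
import Algebra.Properties.CommutativeSemigroup
import Algebra.Properties.Semiring.Sum
open import Data.Bool.Base using (Bool; true; false; if_then_else_; _∧_; _∨_; not)
open import Data.Bool.Properties using (∧-comm; ∧-identityʳ; ∧-zeroʳ; ∨-zeroʳ; ∧-conicalˡ; ∧-conicalʳ)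
open import Data.Empty using (⊥-elim)
open import Data.Fin.Base using (Fin; zero; suc; punchIn)
open import Data.Fin.Properties using (_≟_; punchInᵢ≢i; punchIn-punchOut; any?)
open import Data.Fin.Subset using (Subset; ∣_∣; ⊤; ⊥) renaming (_∈_ to _∈ₛ_)
open import Data.Fin.Subset.Properties using (anySubset?; ∣⊤∣≡n; ∣⊥∣≡0)
import Data.Integer.Base as ℤ
import Data.Integer.Properties as ℤ
open import Data.List.Base as List using (List; []; _∷_; _++_; allFin; cartesianProduct)
open import Data.List.Membership.Propositional using (_∈_)
open import Data.List.Membership.Propositional.Properties
  using (∈-allFin; ∈-map⁺; ∈-++⁺ˡ; ∈-++⁺ʳ; ∈-cartesianProduct⁺)
open import Data.List.Relation.Unary.Any using (here; there)
open import Data.Nat.Base as ℕ using (ℕ; zero; suc; _+_; _*_; _∸_; _≤_; _<_; _<ᵇ_; z≤n; s≤s)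
open import Data.Nat.Properties as ℕ
  using ( +-*-semiring; ≤-refl; ≤-trans; ≤-reflexive; ≤-antisym; +-mono-≤; +-monoˡ-≤; +-monoʳ-≤
        ; +-cancelˡ-≤; +-cancelʳ-≤; m≤m+n; m≤n+m; m≤n*m; ≤ᵇ⇒≤; ≰⇒>; _<?_; _≤?_; m∸n+n≡m; m∸n≤m)
open import Data.Product.Base using (Σ; ∃; ∃₂; _×_; _,_; proj₁; proj₂; swap)
open import Data.Rational.Base as ℚ using (ℚ; 0ℚ; 1ℚ; toℚᵘ)
import Data.Rational.Properties as ℚ
open import Data.Rational.Unnormalised.Base as ℚᵘ using (mkℚᵘ; *≡*; *≤*)
import Data.Rational.Unnormalised.Properties as ℚᵘ
open import Data.Sum.Base using (_⊎_; inj₁; inj₂; [_,_]′)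
open import Data.Vec.Base using ([]; _∷_; lookup; tabulate)
open import Data.Vec.Properties using (lookup∘tabulate; lookup-replicate; []=⇒lookup; lookup⇒[]=)
open import Function.Base using (_∘_; const)
open import Relation.Binary.PropositionalEquality
open import Relation.Nullary.Decidable
  using (Dec; does; yes; no; dec-true; dec-false; ¬?; _×-dec_; decidable-stable)
open import Relation.Nullary.Irrelevant using (Irrelevant)
open import Relation.Nullary.Negation using (¬_; contradiction)
open import Relation.Unary using (Decidable)

open import Defs

open Algebra.Properties.CommutativeSemigroup ℕ.+-commutativeSemigroup
  using (interchange; xy∙z≈xz∙y; xy∙z≈y∙xz)
open Algebra.Properties.Semiring.Sum +-*-semiring
  using (sum; sum-cong-≗; sum-replicate-zero; sum-remove; ∑-distrib-+; ∑-comm; *-distribˡ-sum)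
module ℚΣ = Algebra.Properties.Semiring.Sum (CommutativeRing.semiring ℚ.+-*-commutativeRing)

private
  variable
    n : ℕ

sum-mono-≤ : {f g : Fin n → ℕ} → (∀ i → f i ≤ g i) → sum f ≤ sum g
sum-mono-≤ {zero}  f≤g = z≤n
sum-mono-≤ {suc n} f≤g = +-mono-≤ (f≤g zero) (sum-mono-≤ (f≤g ∘ suc))

sum-zero : {f : Fin n → ℕ} → (∀ i → f i ≡ 0) → sum f ≡ 0
sum-zero {n} f≡0 = trans (sum-cong-≗ f≡0) (sum-replicate-zero n)

sum-ones : ∀ n → sum {n} (const 1) ≡ n
sum-ones zero    = refl
sum-ones (suc n) = cong suc (sum-ones n)

term≤sum : (f : Fin n → ℕ) (i : Fin n) → f i ≤ sum f
term≤sum f zero    = m≤m+n _ _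
term≤sum f (suc i) = ≤-trans (term≤sum (f ∘ suc) i) (m≤n+m _ _)

two-terms≤sum : (f : Fin n → ℕ) {i j : Fin n} → i ≢ j → f i + f j ≤ sum f
two-terms≤sum {suc n} f {i} {j} i≢j = begin
  f i + f j                  ≡⟨ cong (λ k → f i + f k) (punchIn-punchOut i≢j) ⟨
  f i + f (punchIn i _)      ≤⟨ +-monoʳ-≤ (f i) (term≤sum (f ∘ punchIn i) _) ⟩
  f i + sum (f ∘ punchIn i)  ≡⟨ sum-remove f ⟨
  sum f                      ∎
  where open ℕ.≤-Reasoning

sum-single : {f : Fin n → ℕ} (i : Fin n) → (∀ j → j ≢ i → f j ≡ 0) → sum f ≡ f i
sum-single {suc n} {f} i f≡0 = begin
  sum f                      ≡⟨ sum-remove f ⟩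
  f i + sum (f ∘ punchIn i)  ≡⟨ cong (f i +_) (sum-zero (λ j → f≡0 _ (punchInᵢ≢i i j))) ⟩
  f i + 0                    ≡⟨ ℕ.+-identityʳ (f i) ⟩
  f i                        ∎
  where open ≡-Reasoning

sum-positive : (f : Fin n → ℕ) → 0 < sum f → ∃ λ i → 0 < f i
sum-positive {suc n} f 0<∑ with f zero in eq
... | suc _ = zero , ≤-trans (s≤s z≤n) (≤-reflexive (sym eq))
... | zero  with sum-positive (f ∘ suc) 0<∑
...   | i , 0<fi = suc i , 0<fi

⟦_⟧ : Bool → ℕ
⟦ b ⟧ = if b then 1 else 0

if≡⟦⟧* : ∀ b x → (if b then x else 0) ≡ ⟦ b ⟧ * x
if≡⟦⟧* true  x = sym (ℕ.*-identityˡ x)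
if≡⟦⟧* false x = refl

if-zero : ∀ b → (if b then 0 else 0) ≡ 0
if-zero true  = refl
if-zero false = refl

-- Subsets of Fin n are Boolean predicates here, so that ∧, ∨ and not act pointwise by
-- computation; a Subset X enters as lookup X.

⁅_⁆ : Fin n → Fin n → Bool
⁅ i ⁆ j = does (j ≟ i)

⁅⁆-true : {i j : Fin n} → ⁅ i ⁆ j ≡ true → j ≡ i
⁅⁆-true {i = i} {j} with j ≟ i
... | yes j≡i = λ _ → j≡i
... | no  _   = λ ()

_↾_ : (Fin n → ℕ) → (Fin n → Bool) → Fin n → ℕ
(g ↾ P) i = if P i then g i else 0

sumOn : (Fin n → Bool) → (Fin n → ℕ) → ℕ
sumOn P g = sum (g ↾ P)

decrementAt : Fin n → (Fin n → ℕ) → Fin n → ℕ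
decrementAt i g j = g j ∸ ⟦ ⁅ i ⁆ j ⟧

sumOn-+ : (P : Fin n → Bool) (g h : Fin n → ℕ) → sumOn P (λ i → g i + h i) ≡ sumOn P g + sumOn P h
sumOn-+ P g h = trans (sum-cong-≗ pointwise) (∑-distrib-+ (g ↾ P) (h ↾ P))
  where
  pointwise : ∀ i → (if P i then g i + h i else 0) ≡ (g ↾ P) i + (h ↾ P) i
  pointwise i with P i
  ... | true  = refl
  ... | false = refl

module _ {n} {g : Fin n → ℕ} where

  sumOn-congˡ : {P Q : Fin n → Bool} → (∀ i → P i ≡ Q i) → sumOn P g ≡ sumOn Q g
  sumOn-congˡ P≗Q = sum-cong-≗ (λ i → cong (if_then g i else 0) (P≗Q i))

  sumOn-congʳ : (P : Fin n → Bool) {h : Fin n → ℕ} → (∀ i → g i ≡ h i) → sumOn P g ≡ sumOn P h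
  sumOn-congʳ P g≗h = sum-cong-≗ (λ i → cong (if P i then_else 0) (g≗h i))

  sumOn-cong-supp : {P Q : Fin n → Bool} → (∀ i → 0 < g i → P i ≡ Q i) → sumOn P g ≡ sumOn Q g
  sumOn-cong-supp {P} {Q} P≗Q = sum-cong-≗ pointwise
    where
    pointwise : ∀ i → (g ↾ P) i ≡ (g ↾ Q) i
    pointwise i with g i in eq
    ... | zero  = trans (if-zero (P i)) (sym (if-zero (Q i)))
    ... | suc k = cong (if_then suc k else 0) (P≗Q i (≤-trans (s≤s z≤n) (≤-reflexive (sym eq))))

  sumOn-⊆ : {P Q : Fin n → Bool} → (∀ i → P i ≡ true → Q i ≡ true) → sumOn P g ≤ sumOn Q g
  sumOn-⊆ {P} {Q} P⊆Q = sum-mono-≤ pointwise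
    where
    pointwise : ∀ i → (g ↾ P) i ≤ (g ↾ Q) i
    pointwise i with P i in eq
    ... | false = z≤n
    ... | true  rewrite P⊆Q i eq = ≤-refl

  sumOn-none : sumOn (const false) g ≡ 0
  sumOn-none = sum-replicate-zero n

  sumOn-single : {P : Fin n → Bool} (i : Fin n) → (∀ j → P j ≡ true → j ≡ i) → sumOn P g ≡ (g ↾ P) i
  sumOn-single {P} i only-i = sum-single i vanishes
    where
    vanishes : ∀ j → j ≢ i → (g ↾ P) j ≡ 0
    vanishes j j≢i with P j in eq
    ... | true  = contradiction (only-i j eq) j≢i
    ... | false = refl

  sumOn-⁅⁆ : (i : Fin n) → sumOn ⁅ i ⁆ g ≡ g i
  sumOn-⁅⁆ i = trans (sumOn-single i (λ _ → ⁅⁆-true)) (cong (if_then g i else 0) (dec-true (i ≟ i) refl))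

  sumOn-∧⁅⁆ : {X : Fin n → Bool} {i : Fin n} → X i ≡ true → sumOn (λ k → X k ∧ ⁅ i ⁆ k) g ≡ g i
  sumOn-∧⁅⁆ {X} {i} Xi = trans (sumOn-congˡ pointwise) (sumOn-⁅⁆ i)
    where
    pointwise : ∀ k → X k ∧ ⁅ i ⁆ k ≡ ⁅ i ⁆ k
    pointwise k with k ≟ i
    ... | yes refl = trans (∧-identityʳ (X k)) Xi
    ... | no  _    = ∧-zeroʳ (X k)

  sumOn-decrementAt : {P : Fin n → Bool} {i : Fin n} → 0 < g i →
                      sumOn P g ≡ sumOn P (decrementAt i g) + ⟦ P i ⟧
  sumOn-decrementAt {P} {i} 0<gi = begin
    sumOn P g                           ≡⟨ sumOn-congʳ P (λ j → sym (m∸n+n≡m (δ≤g j))) ⟩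
    sumOn P (λ j → g⁻ j + δ j)          ≡⟨ sumOn-+ P g⁻ δ ⟩
    sumOn P g⁻ + sumOn P δ              ≡⟨ cong (sumOn P g⁻ +_) (sum-single i off-i) ⟩
    sumOn P g⁻ + (δ ↾ P) i              ≡⟨ cong (λ d → sumOn P g⁻ + (if P i then ⟦ d ⟧ else 0))
                                             (dec-true (i ≟ i) refl) ⟩
    sumOn P g⁻ + ⟦ P i ⟧                ∎
    where
    open ≡-Reasoning
    g⁻ = decrementAt i g
    δ : Fin n → ℕ
    δ j = ⟦ ⁅ i ⁆ j ⟧
    δ≤g : ∀ j → δ j ≤ g j
    δ≤g j with j ≟ i
    ... | yes refl = 0<gi
    ... | no  _    = z≤n
    off-i : ∀ j → j ≢ i → (δ ↾ P) j ≡ 0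
    off-i j j≢i rewrite dec-false (j ≟ i) j≢i = if-zero (P j)

  sum-decrementAt : {i : Fin n} → 0 < g i → suc (sum (decrementAt i g)) ≡ sum g
  sum-decrementAt 0<gi = trans (ℕ.+-comm 1 _) (sym (sumOn-decrementAt {P = const true} 0<gi))

  sumOn-split : (P Q : Fin n → Bool) →
                sumOn P g ≡ sumOn (λ i → P i ∧ not (Q i)) g + sumOn (λ i → P i ∧ Q i) g
  sumOn-split P Q =
    trans (sum-cong-≗ pointwise) (∑-distrib-+ (g ↾ (λ i → P i ∧ not (Q i))) (g ↾ (λ i → P i ∧ Q i)))
    where
    pointwise : ∀ i → (g ↾ P) i ≡ (g ↾ (λ i → P i ∧ not (Q i))) i + (g ↾ (λ i → P i ∧ Q i)) i
    pointwise i with P i | Q i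
    ... | true  | true  = refl
    ... | true  | false = sym (ℕ.+-identityʳ (g i))
    ... | false | _     = refl

  sumOn-modular : (P Q : Fin n → Bool) →
                  sumOn (λ i → P i ∧ Q i) g + sumOn (λ i → P i ∨ Q i) g ≡ sumOn P g + sumOn Q g
  sumOn-modular P Q = begin
    sum (g ↾ P∧Q) + sum (g ↾ P∨Q)                ≡⟨ ∑-distrib-+ (g ↾ P∧Q) (g ↾ P∨Q) ⟨
    sum (λ i → (g ↾ P∧Q) i + (g ↾ P∨Q) i)        ≡⟨ sum-cong-≗ pointwise ⟩
    sum (λ i → (g ↾ P) i + (g ↾ Q) i)            ≡⟨ ∑-distrib-+ (g ↾ P) (g ↾ Q) ⟩
    sum (g ↾ P) + sum (g ↾ Q)                    ∎
    where
    open ≡-Reasoning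
    P∧Q P∨Q : Fin n → Bool
    P∧Q i = P i ∧ Q i
    P∨Q i = P i ∨ Q i
    pointwise : ∀ i → (g ↾ P∧Q) i + (g ↾ P∨Q) i ≡ (g ↾ P) i + (g ↾ Q) i
    pointwise i with P i | Q i
    ... | true  | true  = refl
    ... | true  | false = ℕ.+-comm 0 (g i)
    ... | false | _     = refl

  sumOn-+-mono-≤ : (P Q R S : Fin n → Bool) → (∀ i → ⟦ P i ⟧ + ⟦ Q i ⟧ ≤ ⟦ R i ⟧ + ⟦ S i ⟧) →
                   sumOn P g + sumOn Q g ≤ sumOn R g + sumOn S g
  sumOn-+-mono-≤ P Q R S ⟦⟧-mono = begin
    sum (g ↾ P) + sum (g ↾ Q)              ≡⟨ ∑-distrib-+ (g ↾ P) (g ↾ Q) ⟨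
    sum (λ i → (g ↾ P) i + (g ↾ Q) i)      ≤⟨ sum-mono-≤ pointwise ⟩
    sum (λ i → (g ↾ R) i + (g ↾ S) i)      ≡⟨ ∑-distrib-+ (g ↾ R) (g ↾ S) ⟩
    sum (g ↾ R) + sum (g ↾ S)              ∎
    where
    open ℕ.≤-Reasoning
    as-product : ∀ A B i → (g ↾ A) i + (g ↾ B) i ≡ (⟦ A i ⟧ + ⟦ B i ⟧) * g i
    as-product A B i = trans (cong₂ _+_ (if≡⟦⟧* (A i) (g i)) (if≡⟦⟧* (B i) (g i)))
                             (sym (ℕ.*-distribʳ-+ (g i) ⟦ A i ⟧ ⟦ B i ⟧))
    pointwise : ∀ i → (g ↾ P) i + (g ↾ Q) i ≤ (g ↾ R) i + (g ↾ S) i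
    pointwise i = begin
      (g ↾ P) i + (g ↾ Q) i       ≡⟨ as-product P Q i ⟩
      (⟦ P i ⟧ + ⟦ Q i ⟧) * g i   ≤⟨ ℕ.*-monoˡ-≤ (g i) (⟦⟧-mono i) ⟩
      (⟦ R i ⟧ + ⟦ S i ⟧) * g i   ≡⟨ as-product R S i ⟨
      (g ↾ R) i + (g ↾ S) i       ∎

  sumOn≡1⇒unique : {P : Fin n → Bool} → sumOn P g ≡ 1 →
                   ∃ λ i → P i ≡ true × 0 < g i × (∀ j → P j ≡ true → 0 < g j → j ≡ i)
  sumOn≡1⇒unique {P} ∑≡1 with sum-positive (g ↾ P) (≤-reflexive (sym ∑≡1))
  ... | i , 0<gᵢ with P i in Pi
  ...   | true = i , Pi , 0<gᵢ , unique
    where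
    unique : ∀ j → P j ≡ true → 0 < g j → j ≡ i
    unique j Pj 0<gⱼ with j ≟ i
    ... | yes j≡i = j≡i
    ... | no  j≢i = contradiction (≤-trans (+-mono-≤ 0<gᵢ′ 0<gⱼ′) two≤∑) λ { (s≤s ()) }
      where
      0<gᵢ′ : 0 < (g ↾ P) i
      0<gᵢ′ rewrite Pi = 0<gᵢ
      0<gⱼ′ : 0 < (g ↾ P) j
      0<gⱼ′ rewrite Pj = 0<gⱼ
      two≤∑ : (g ↾ P) i + (g ↾ P) j ≤ 1
      two≤∑ = ≤-trans (two-terms≤sum (g ↾ P) (j≢i ∘ sym)) (≤-reflexive ∑≡1)

sumOn-∸ : (P : Fin n → Bool) {g h : Fin n → ℕ} → (∀ i → h i ≤ g i) →
          sumOn P (λ i → g i ∸ h i) + sumOn P h ≡ sumOn P g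
sumOn-∸ P {g} {h} h≤g =
  trans (sym (sumOn-+ P (λ i → g i ∸ h i) h)) (sumOn-congʳ P (λ i → m∸n+n≡m (h≤g i)))

sumOn-const : (P : Fin n → Bool) (k : ℕ) → sumOn P (const k) ≡ k * sumOn P (const 1)
sumOn-const P k = trans (sum-cong-≗ pointwise) (sym (*-distribˡ-sum k (const 1 ↾ P)))
  where
  pointwise : ∀ i → (if P i then k else 0) ≡ k * ⟦ P i ⟧
  pointwise i with P i
  ... | true  = sym (ℕ.*-identityʳ k)
  ... | false = sym (ℕ.*-zeroʳ k)

sumOn-fibres : ∀ {k} (φ : Fin k → Fin n) (X : Fin n → Bool) (f : Fin k → ℕ) →
               sumOn X (λ i → sumOn (⁅ i ⁆ ∘ φ) f) ≡ sumOn (X ∘ φ) f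
sumOn-fibres {n} {k} φ X f = begin
  sum (λ i → if X i then sum (fibre i) else 0)    ≡⟨ sum-cong-≗ push-inside ⟩
  sum (λ i → sum (λ e → X-fibre i e))              ≡⟨ ∑-comm X-fibre ⟩
  sum (λ e → sum (λ i → X-fibre i e))              ≡⟨ sum-cong-≗ (λ e → sum-single (φ e) (off-fibre e)) ⟩
  sum (λ e → if X (φ e) then fibre (φ e) e else 0) ≡⟨ sum-cong-≗ on-fibre ⟩
  sumOn (X ∘ φ) f                                  ∎
  where
  open ≡-Reasoning
  fibre X-fibre : Fin n → Fin k → ℕ
  fibre i = f ↾ (⁅ i ⁆ ∘ φ)
  X-fibre i e = if X i then fibre i e else 0
  push-inside : ∀ i → (if X i then sum (fibre i) else 0) ≡ sum (λ e → if X i then fibre i e else 0)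
  push-inside i with X i
  ... | true  = refl
  ... | false = sym (sum-replicate-zero k)
  off-fibre : ∀ e i → i ≢ φ e → (if X i then fibre i e else 0) ≡ 0
  off-fibre e i i≢φe rewrite dec-false (φ e ≟ i) (i≢φe ∘ sym) = if-zero (X i)
  on-fibre : ∀ e → (if X (φ e) then fibre (φ e) e else 0) ≡ (f ↾ (X ∘ φ)) e
  on-fibre e rewrite dec-true (φ e ≟ φ e) refl = refl

count≡sumOn : ∀ n (P : Fin n → Bool) → count n P ≡ sumOn P (const 1)
count≡sumOn zero    P = refl
count≡sumOn (suc n) P = cong (⟦ P zero ⟧ +_) (count≡sumOn n (P ∘ suc))

∣∣≡sumOn : (X : Subset n) → ∣ X ∣ ≡ sumOn (lookup X) (const 1)
∣∣≡sumOn []          = refl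
∣∣≡sumOn (true ∷ X)  = cong suc (∣∣≡sumOn X)
∣∣≡sumOn (false ∷ X) = ∣∣≡sumOn X

∣tabulate∣ : (X : Fin n → Bool) → ∣ tabulate X ∣ ≡ sumOn X (const 1)
∣tabulate∣ X = trans (∣∣≡sumOn (tabulate X)) (sumOn-congˡ (lookup∘tabulate X))

⟦⟧-submodular : ∀ x x′ y y′ →
  ⟦ (x ∧ x′) ∧ (y ∨ y′) ⟧ + ⟦ (x ∨ x′) ∧ (y ∧ y′) ⟧ ≤ ⟦ x ∧ y ⟧ + ⟦ x′ ∧ y′ ⟧
⟦⟧-submodular true  true  true  true  = ≤ᵇ⇒≤ _ _ _
⟦⟧-submodular true  true  true  false = ≤ᵇ⇒≤ _ _ _
⟦⟧-submodular true  true  false true  = ≤ᵇ⇒≤ _ _ _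
⟦⟧-submodular true  true  false false = ≤ᵇ⇒≤ _ _ _
⟦⟧-submodular true  false true  true  = ≤ᵇ⇒≤ _ _ _
⟦⟧-submodular true  false true  false = ≤ᵇ⇒≤ _ _ _
⟦⟧-submodular true  false false true  = ≤ᵇ⇒≤ _ _ _
⟦⟧-submodular true  false false false = ≤ᵇ⇒≤ _ _ _
⟦⟧-submodular false true  true  true  = ≤ᵇ⇒≤ _ _ _
⟦⟧-submodular false true  true  false = ≤ᵇ⇒≤ _ _ _
⟦⟧-submodular false true  false true  = ≤ᵇ⇒≤ _ _ _
⟦⟧-submodular false true  false false = ≤ᵇ⇒≤ _ _ _
⟦⟧-submodular false false true  true  = ≤ᵇ⇒≤ _ _ _
⟦⟧-submodular false false true  false = ≤ᵇ⇒≤ _ _ _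
⟦⟧-submodular false false false true  = ≤ᵇ⇒≤ _ _ _
⟦⟧-submodular false false false false = ≤ᵇ⇒≤ _ _ _

transpose : ∀ {a b} → BipGraph a b → BipGraph b a
transpose G = record { m = m G ; ends = swap ∘ ends G ; simple = λ eq → simple G (cong swap eq) }

module _ {a b : ℕ} (G : BipGraph a b) where

  between : (Fin (m G) → ℕ) → (Fin a → Bool) → (Fin b → Bool) → ℕ
  between c X Y = sumOn (λ e → X (tail G e) ∧ Y (head G e)) c

  outflow : (Fin (m G) → ℕ) → Fin a → ℕ
  outflow c i = sumOn (⁅ i ⁆ ∘ tail G) c

  inflow : (Fin (m G) → ℕ) → Fin b → ℕ
  inflow c j = sumOn (⁅ j ⁆ ∘ head G) c

  between-all : (c : Fin (m G) → ℕ) (X : Fin a → Bool) → between c X (const true) ≡ sumOn (X ∘ tail G) c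
  between-all c X = sumOn-congˡ (λ e → ∧-identityʳ (X (tail G e)))

  sumOn-outflow : (c : Fin (m G) → ℕ) (X : Fin a → Bool) → sumOn X (outflow c) ≡ sumOn (X ∘ tail G) c
  sumOn-outflow c X = sumOn-fibres (tail G) X c

  sumOn-inflow : (c : Fin (m G) → ℕ) (Y : Fin b → Bool) → sumOn Y (inflow c) ≡ sumOn (Y ∘ head G) c
  sumOn-inflow c Y = sumOn-fibres (head G) Y c

  between-submodular : (c : Fin (m G) → ℕ) (X X′ : Fin a → Bool) (Y Y′ : Fin b → Bool) →
    between c (λ i → X i ∧ X′ i) (λ j → Y j ∨ Y′ j) + between c (λ i → X i ∨ X′ i) (λ j → Y j ∧ Y′ j)
      ≤ between c X Y + between c X′ Y′
  between-submodular c X X′ Y Y′ = sumOn-+-mono-≤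
    (λ e → (X (tail G e) ∧ X′ (tail G e)) ∧ (Y (head G e) ∨ Y′ (head G e)))
    (λ e → (X (tail G e) ∨ X′ (tail G e)) ∧ (Y (head G e) ∧ Y′ (head G e)))
    (λ e → X (tail G e) ∧ Y (head G e))
    (λ e → X′ (tail G e) ∧ Y′ (head G e))
    (λ e → ⟦⟧-submodular (X (tail G e)) (X′ (tail G e)) (Y (head G e)) (Y′ (head G e)))

between-transpose : ∀ {a b} (G : BipGraph a b) (c : Fin (m G) → ℕ) X Y →
                    between (transpose G) c Y X ≡ between G c X Y
between-transpose G c X Y = sumOn-congˡ (λ e → ∧-comm (Y (head G e)) (X (tail G e)))

-- Gale's supply–demand theorem

module SupplyDemand {a b : ℕ} (G : BipGraph a b) (s : Fin a → ℕ) (t : Fin b → ℕ) where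

  -- When ∑ s = ∑ t this says s(X) ≤ c(X,Y) + t(B ∖ Y): the supply of X fits through the
  -- edges into Y and the demand outside Y.
  GaleInequality : (Fin (m G) → ℕ) → (Fin a → Bool) → (Fin b → Bool) → Set
  GaleInequality c X Y = sumOn X s + sumOn Y t ≤ between G c X Y + sum s

  GaleCondition : (Fin (m G) → ℕ) → Set
  GaleCondition c = ∀ X Y → GaleInequality c X Y

  Tight : (Fin (m G) → ℕ) → (Fin a → Bool) → (Fin b → Bool) → Set
  Tight c X Y = sumOn X s + sumOn Y t ≡ between G c X Y + sum s

  IsFlow : (Fin (m G) → ℕ) → Set
  IsFlow f = (∀ i → outflow G f i ≡ s i) × (∀ j → inflow G f j ≡ t j)

  GaleInequality-cong : {c : Fin (m G) → ℕ} {X X′ : Fin a → Bool} {Y Y′ : Fin b → Bool} →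
                        (∀ i → X i ≡ X′ i) → (∀ j → Y j ≡ Y′ j) →
                        GaleInequality c X Y → GaleInequality c X′ Y′
  GaleInequality-cong X≗X′ Y≗Y′ = subst₂ _≤_
    (cong₂ _+_ (sumOn-congˡ X≗X′) (sumOn-congˡ Y≗Y′))
    (cong (_+ sum s) (sumOn-congˡ (λ e → cong₂ _∧_ (X≗X′ (tail G e)) (Y≗Y′ (head G e)))))

  gale-or-violated : (c : Fin (m G) → ℕ) → GaleCondition c ⊎ ∃₂ λ X Y → ¬ GaleInequality c X Y
  gale-or-violated c with anySubset? (λ X → anySubset? (λ Y → ¬? (inequality? (lookup X) (lookup Y))))
    where
    inequality? : ∀ X Y → Dec (GaleInequality c X Y)
    inequality? X Y = _ ≤? _
  ... | yes (X , Y , violated) = inj₂ (lookup X , lookup Y , violated)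
  ... | no  none               = inj₁ λ X Y →
    GaleInequality-cong (lookup∘tabulate X) (lookup∘tabulate Y)
      (decidable-stable (_ ≤? _) (λ violated → none (tabulate X , tabulate Y , violated)))

  flow-balanced : {f : Fin (m G) → ℕ} → IsFlow f → sum s ≡ sum t
  flow-balanced {f} (out≡s , in≡t) = begin
    sum s                             ≡⟨ sumOn-congʳ (const true) (sym ∘ out≡s) ⟩
    sumOn (const true) (outflow G f)  ≡⟨ sumOn-outflow G f (const true) ⟩
    sum f                             ≡⟨ sumOn-inflow G f (const true) ⟨
    sumOn (const true) (inflow G f)   ≡⟨ sumOn-congʳ (const true) in≡t ⟩
    sum t                             ∎
    where open ≡-Reasoning

  flow⇒gale : {f : Fin (m G) → ℕ} → IsFlow f → GaleCondition f
  flow⇒gale {f} flow@(out≡s , in≡t) X Y = begin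
    sumOn X s + sumOn Y t                      ≡⟨ cong (_+ sumOn Y t) X-as-edges ⟩
    (sumOn Xₜ∖Yₕ f + f⟨X,Y⟩) + sumOn Y t       ≤⟨ +-monoˡ-≤ _ (+-monoˡ-≤ f⟨X,Y⟩ (sumOn-⊆ Xₜ∖Yₕ⊆)) ⟩
    (sumOn (not ∘ Yₕ) f + f⟨X,Y⟩) + sumOn Y t  ≡⟨ cong (λ x → (x + f⟨X,Y⟩) + sumOn Y t) Ȳ-as-edges ⟨
    (sumOn (not ∘ Y) t + f⟨X,Y⟩) + sumOn Y t   ≡⟨ xy∙z≈y∙xz (sumOn (not ∘ Y) t) f⟨X,Y⟩ (sumOn Y t) ⟩
    f⟨X,Y⟩ + (sumOn (not ∘ Y) t + sumOn Y t)   ≡⟨ cong (f⟨X,Y⟩ +_) (sumOn-split (const true) Y) ⟨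
    f⟨X,Y⟩ + sum t                             ≡⟨ cong (f⟨X,Y⟩ +_) (flow-balanced flow) ⟨
    f⟨X,Y⟩ + sum s                             ∎
    where
    open ℕ.≤-Reasoning
    f⟨X,Y⟩ = between G f X Y
    Xₜ Yₕ Xₜ∖Yₕ : Fin (m G) → Bool
    Xₜ = X ∘ tail G
    Yₕ = Y ∘ head G
    Xₜ∖Yₕ e = Xₜ e ∧ not (Yₕ e)
    Xₜ∖Yₕ⊆ : ∀ e → Xₜ∖Yₕ e ≡ true → not (Yₕ e) ≡ true
    Xₜ∖Yₕ⊆ e = ∧-conicalʳ (Xₜ e) (not (Yₕ e))
    X-as-edges : sumOn X s ≡ sumOn Xₜ∖Yₕ f + f⟨X,Y⟩
    X-as-edges = trans (sumOn-congʳ X (sym ∘ out≡s)) (trans (sumOn-outflow G f X) (sumOn-split Xₜ Yₕ))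
    Ȳ-as-edges : sumOn (not ∘ Y) t ≡ sumOn (not ∘ Yₕ) f
    Ȳ-as-edges = trans (sumOn-congʳ (not ∘ Y) (sym ∘ in≡t)) (sumOn-inflow G f (not ∘ Y))

  tight-∧∨ : {c : Fin (m G) → ℕ} → GaleCondition c → ∀ {X X′ Y Y′} → Tight c X Y → Tight c X′ Y′ →
             Tight c (λ i → X i ∧ X′ i) (λ j → Y j ∨ Y′ j)
  tight-∧∨ {c} gale {X} {X′} {Y} {Y′} tight tight′ = squeeze (gale X∧ Y∨) (gale X∨ Y∧) (begin
    R X∧ Y∨ + R X∨ Y∧  ≤⟨ R-submodular ⟩
    R X Y + R X′ Y′    ≡⟨ cong₂ _+_ tight tight′ ⟨
    L X Y + L X′ Y′    ≡⟨ L-modular ⟨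
    L X∧ Y∨ + L X∨ Y∧  ∎)
    where
    open ℕ.≤-Reasoning
    X∧ X∨ : Fin a → Bool
    X∧ i = X i ∧ X′ i
    X∨ i = X i ∨ X′ i
    Y∧ Y∨ : Fin b → Bool
    Y∧ j = Y j ∧ Y′ j
    Y∨ j = Y j ∨ Y′ j
    L : (Fin a → Bool) → (Fin b → Bool) → ℕ
    L X Y = sumOn X s + sumOn Y t
    R : (Fin a → Bool) → (Fin b → Bool) → ℕ
    R X Y = between G c X Y + sum s
    R-submodular : R X∧ Y∨ + R X∨ Y∧ ≤ R X Y + R X′ Y′
    R-submodular = begin
      R X∧ Y∨ + R X∨ Y∧
        ≡⟨ interchange (between G c X∧ Y∨) (sum s) (between G c X∨ Y∧) (sum s) ⟩
      (between G c X∧ Y∨ + between G c X∨ Y∧) + (sum s + sum s)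
        ≤⟨ +-monoˡ-≤ (sum s + sum s) (between-submodular G c X X′ Y Y′) ⟩
      (between G c X Y + between G c X′ Y′) + (sum s + sum s)
        ≡⟨ interchange (between G c X Y) (between G c X′ Y′) (sum s) (sum s) ⟩
      R X Y + R X′ Y′ ∎
    L-modular : L X∧ Y∨ + L X∨ Y∧ ≡ L X Y + L X′ Y′
    L-modular = begin-equality
      L X∧ Y∨ + L X∨ Y∧
        ≡⟨ interchange (sumOn X∧ s) (sumOn Y∨ t) (sumOn X∨ s) (sumOn Y∧ t) ⟩
      (sumOn X∧ s + sumOn X∨ s) + (sumOn Y∨ t + sumOn Y∧ t)
        ≡⟨ cong₂ _+_ (sumOn-modular X X′)
                     (trans (ℕ.+-comm (sumOn Y∨ t) (sumOn Y∧ t)) (sumOn-modular Y Y′)) ⟩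
      (sumOn X s + sumOn X′ s) + (sumOn Y t + sumOn Y′ t)
        ≡⟨ interchange (sumOn X s) (sumOn X′ s) (sumOn Y t) (sumOn Y′ t) ⟩
      L X Y + L X′ Y′ ∎
    squeeze : ∀ {l₁ r₁ l₂ r₂} → l₁ ≤ r₁ → l₂ ≤ r₂ → r₁ + r₂ ≤ l₁ + l₂ → l₁ ≡ r₁
    squeeze {l₁} l₁≤r₁ l₂≤r₂ r≤l = ≤-antisym l₁≤r₁ (+-cancelʳ-≤ _ _ _ (≤-trans r≤l (+-monoʳ-≤ l₁ l₂≤r₂)))

  violated⇒tight : {c : Fin (m G) → ℕ} {e : Fin (m G)} {X : Fin a → Bool} {Y : Fin b → Bool} →
                   0 < c e → GaleInequality c X Y → ¬ GaleInequality (decrementAt e c) X Y →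
                   Tight c X Y × X (tail G e) ≡ true × Y (head G e) ≡ true
  violated⇒tight {c} {e} {X} {Y} 0<ce holds violated =
    ≤-antisym holds (≤-trans (≤-reflexive tight-rhs) (≰⇒> violated)) ,
    ∧-conicalˡ (X (tail G e)) (Y (head G e)) crosses ,
    ∧-conicalʳ (X (tail G e)) (Y (head G e)) crosses
    where
    D = between G (decrementAt e c) X Y
    split : between G c X Y ≡ D + ⟦ X (tail G e) ∧ Y (head G e) ⟧
    split = sumOn-decrementAt {P = λ e′ → X (tail G e′) ∧ Y (head G e′)} 0<ce
    crosses : X (tail G e) ∧ Y (head G e) ≡ true
    crosses with X (tail G e) ∧ Y (head G e) in eq
    ... | true  = refl
    ... | false = contradiction (≤-trans holds (≤-reflexive (cong (_+ sum s) unchanged))) violated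
      where
      unchanged : between G c X Y ≡ D
      unchanged = trans split (trans (cong (λ x → D + ⟦ x ⟧) eq) (ℕ.+-identityʳ D))
    tight-rhs : between G c X Y + sum s ≡ suc (D + sum s)
    tight-rhs = begin-equality
      between G c X Y + sum s  ≡⟨ cong (_+ sum s) (trans split (cong (λ x → D + ⟦ x ⟧) crosses)) ⟩
      (D + 1) + sum s          ≡⟨ ℕ.+-assoc D 1 (sum s) ⟩
      D + suc (sum s)          ≡⟨ ℕ.+-suc D (sum s) ⟩
      suc (D + sum s)          ∎
      where open ℕ.≤-Reasoning

  Critical : (Fin (m G) → ℕ) → Set
  Critical c = ∀ e → 0 < c e → ∃₂ λ X Y → Tight c X Y × X (tail G e) ≡ true × Y (head G e) ≡ true

  tight-cover : {c : Fin (m G) → ℕ} → GaleCondition c → Critical c → ∀ i (es : List (Fin (m G))) →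
    ∃₂ λ X Y → Tight c X Y × X i ≡ true × (∀ {e} → e ∈ es → tail G e ≡ i → 0 < c e → Y (head G e) ≡ true)
  tight-cover {c} gale critical i [] = const true , const false , tight-all-none , refl , λ ()
    where
    tight-all-none : Tight c (const true) (const false)
    tight-all-none = begin
      sum s + sumOn (const false) t                   ≡⟨ cong (sum s +_) (sumOn-none {g = t}) ⟩
      sum s + 0                                       ≡⟨ ℕ.+-comm (sum s) 0 ⟩
      0 + sum s                                       ≡⟨ cong (_+ sum s) (sumOn-none {g = c}) ⟨
      between G c (const true) (const false) + sum s  ∎
      where open ≡-Reasoning
  tight-cover {c} gale critical i (e ∷ es) with tight-cover gale critical i es
  ... | X , Y , tight , Xi , covers with tail G e ≟ i | 0 <? c e
  ...   | yes refl | yes 0<ce =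
    let X′ , Y′ , tight′ , X′i , Y′h = critical e 0<ce
        covers′ : ∀ {e′} → e′ ∈ e ∷ es → tail G e′ ≡ tail G e → 0 < c e′ →
                  Y (head G e′) ∨ Y′ (head G e′) ≡ true
        covers′ = λ where
          (here refl)   _   _   → trans (cong (Y (head G e) ∨_) Y′h) (∨-zeroʳ _)
          (there e′∈es) tl≡ 0<c → cong (_∨ Y′ _) (covers e′∈es tl≡ 0<c)
    in (λ k → X k ∧ X′ k) , (λ j → Y j ∨ Y′ j) , tight-∧∨ gale tight tight′ , cong₂ _∧_ Xi X′i , covers′
  ...   | yes _    | no ¬0<ce = X , Y , tight , Xi , λ where
    (here refl)   _   0<ce → contradiction 0<ce ¬0<ce
    (there e′∈es) tl≡ 0<c  → covers e′∈es tl≡ 0<c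
  ...   | no tl≢i  | _        = X , Y , tight , Xi , λ where
    (here refl)   tl≡ _    → contradiction tl≡ tl≢i
    (there e′∈es) tl≡ 0<c  → covers e′∈es tl≡ 0<c

  -- Removing i from X lowers the left side of the tight pair by s i and the right side by the
  -- outflow at i, since Y contains every neighbour of i.
  outflow≤supply : {c : Fin (m G) → ℕ} → GaleCondition c → ∀ {i X Y} → Tight c X Y → X i ≡ true →
                   (∀ {e} → tail G e ≡ i → 0 < c e → Y (head G e) ≡ true) → outflow G c i ≤ s i
  outflow≤supply {c} gale {i} {X} {Y} tight Xi covers = +-cancelˡ-≤ (c⟨X⁻,Y⟩ + sum s) _ _ (begin
    (c⟨X⁻,Y⟩ + sum s) + outflow G c i  ≡⟨ xy∙z≈xz∙y c⟨X⁻,Y⟩ (sum s) (outflow G c i) ⟩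
    (c⟨X⁻,Y⟩ + outflow G c i) + sum s  ≡⟨ cong (_+ sum s) between-split ⟨
    between G c X Y + sum s            ≡⟨ tight ⟨
    sumOn X s + sumOn Y t              ≡⟨ cong (_+ sumOn Y t) supply-split ⟩
    (sumOn X⁻ s + s i) + sumOn Y t     ≡⟨ xy∙z≈xz∙y (sumOn X⁻ s) (s i) (sumOn Y t) ⟩
    (sumOn X⁻ s + sumOn Y t) + s i     ≤⟨ +-monoˡ-≤ (s i) (gale X⁻ Y) ⟩
    (c⟨X⁻,Y⟩ + sum s) + s i            ∎)
    where
    open ℕ.≤-Reasoning
    X⁻ : Fin a → Bool
    X⁻ k = X k ∧ not (⁅ i ⁆ k)
    c⟨X⁻,Y⟩ = between G c X⁻ Y
    supply-split : sumOn X s ≡ sumOn X⁻ s + s i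
    supply-split = trans (sumOn-split X ⁅ i ⁆) (cong (sumOn X⁻ s +_) (sumOn-∧⁅⁆ {X = X} Xi))
    reassociate : ∀ x y q → (x ∧ y) ∧ not q ≡ (x ∧ not q) ∧ y
    reassociate true  y q = ∧-comm y (not q)
    reassociate false y q = refl
    row-i : ∀ e → 0 < c e → (X (tail G e) ∧ Y (head G e)) ∧ ⁅ i ⁆ (tail G e) ≡ ⁅ i ⁆ (tail G e)
    row-i e 0<ce with tail G e ≟ i
    ... | yes refl = trans (∧-identityʳ _) (cong₂ _∧_ Xi (covers refl 0<ce))
    ... | no  _    = ∧-zeroʳ _
    between-split : between G c X Y ≡ c⟨X⁻,Y⟩ + outflow G c i
    between-split = trans (sumOn-split (λ e → X (tail G e) ∧ Y (head G e)) (⁅ i ⁆ ∘ tail G))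
      (cong₂ _+_ (sumOn-congˡ (λ e → reassociate (X (tail G e)) (Y (head G e)) (⁅ i ⁆ (tail G e))))
                 (sumOn-cong-supp row-i))

  supply≤outflow : {c : Fin (m G) → ℕ} → GaleCondition c → sum s ≡ sum t → ∀ i → s i ≤ outflow G c i
  supply≤outflow {c} gale balanced i = +-cancelʳ-≤ (sum s) _ _ (begin
    s i + sum s                              ≡⟨ cong₂ _+_ (sumOn-⁅⁆ i) (sym balanced) ⟨
    sumOn ⁅ i ⁆ s + sum t                    ≤⟨ gale ⁅ i ⁆ (const true) ⟩
    between G c ⁅ i ⁆ (const true) + sum s   ≡⟨ cong (_+ sum s) (between-all G c ⁅ i ⁆) ⟩
    outflow G c i + sum s                    ∎)
    where open ℕ.≤-Reasoning

  critical⇒outflow : {c : Fin (m G) → ℕ} → GaleCondition c → sum s ≡ sum t → Critical c →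
                     ∀ i → outflow G c i ≡ s i
  critical⇒outflow gale balanced critical i with tight-cover gale critical i (allFin _)
  ... | X , Y , tight , Xi , covers =
    ≤-antisym (outflow≤supply gale tight Xi (covers (∈-allFin _))) (supply≤outflow gale balanced i)

module Transportation {a b : ℕ} (G : BipGraph a b) (s : Fin a → ℕ) (t : Fin b → ℕ) where

  open SupplyDemand G s t public
  private
    module ᵀ = SupplyDemand (transpose G) t s

  module _ {c : Fin (m G) → ℕ} (balanced : sum s ≡ sum t) where

    gale-transpose : GaleCondition c → ᵀ.GaleCondition c
    gale-transpose gale Y X = subst₂ _≤_ (ℕ.+-comm (sumOn X s) (sumOn Y t))
      (cong₂ _+_ (sym (between-transpose G c X Y)) balanced) (gale X Y)

    critical-transpose : Critical c → ᵀ.Critical c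
    critical-transpose critical e 0<ce with critical e 0<ce
    ... | X , Y , tight , Xₜ , Yₕ = Y , X , tight′ , Yₕ , Xₜ
      where
      tight′ : ᵀ.Tight c Y X
      tight′ = trans (ℕ.+-comm (sumOn Y t) (sumOn X s))
                 (trans tight (cong₂ _+_ (sym (between-transpose G c X Y)) balanced))

    critical⇒flow : GaleCondition c → Critical c → IsFlow c
    critical⇒flow gale critical =
      critical⇒outflow gale balanced critical ,
      ᵀ.critical⇒outflow (gale-transpose gale) (sym balanced) (critical-transpose critical)

  gale? : (c : Fin (m G) → ℕ) → Dec (GaleCondition c)
  gale? c with gale-or-violated c
  ... | inj₁ gale                 = yes gale
  ... | inj₂ (X , Y , violated)  = no (λ gale → violated (gale X Y))

  gale⇒flow : {c : Fin (m G) → ℕ} → sum s ≡ sum t → GaleCondition c →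
              ∃ λ f → (∀ e → f e ≤ c e) × IsFlow f
  gale⇒flow {c} balanced = go (sum c) c ≤-refl
    where
    go : ∀ k c → sum c ≤ k → GaleCondition c → ∃ λ f → (∀ e → f e ≤ c e) × IsFlow f
    go k c ∑c≤k gale with any? (λ e → (0 <? c e) ×-dec gale? (decrementAt e c))
    go zero    c ∑c≤0 gale | yes (e , 0<ce , _) =
      contradiction (≤-trans 0<ce (≤-trans (term≤sum c e) ∑c≤0)) λ ()
    go (suc k) c ∑c≤k gale | yes (e , 0<ce , gale′)
      with go k (decrementAt e c) (ℕ.s≤s⁻¹ (subst (_≤ suc k) (sym (sum-decrementAt {g = c} 0<ce)) ∑c≤k))
              gale′
    ... | f , f≤c′ , flow = f , (λ e′ → ≤-trans (f≤c′ e′) (m∸n≤m (c e′) ⟦ ⁅ e ⁆ e′ ⟧)) , flow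
    go k c ∑c≤k gale | no irreducible = c , (λ _ → ≤-refl) , critical⇒flow balanced gale critical
      where
      critical : Critical c
      critical e 0<ce with gale-or-violated (decrementAt e c)
      ... | inj₁ gale′               = contradiction (e , 0<ce , gale′) irreducible
      ... | inj₂ (X , Y , violated) = X , Y , violated⇒tight 0<ce (gale X Y) violated

-- Perfect matchings and regular multigraphs

-- IsPerfectMatching G M unfolds to ExactlyOnce (tail G) M × ExactlyOnce (head G) M.
module _ {k n : ℕ} (φ : Fin k → Fin n) where

  ExactlyOnce : Subset k → Set
  ExactlyOnce M = ∀ i → Σ (Fin k) λ e → (e ∈ₛ M) × (φ e ≡ i) × (∀ f → f ∈ₛ M → φ f ≡ i → f ≡ e)

  exactlyOnce⇒fibres≡1 : {M : Subset k} → ExactlyOnce M → ∀ i → sumOn (⁅ i ⁆ ∘ φ) (⟦_⟧ ∘ lookup M) ≡ 1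
  exactlyOnce⇒fibres≡1 {M} once i with once i
  ... | e , e∈M , refl , unique = trans (sum-single e off-e) on-e
    where
    on-e : (if ⁅ φ e ⁆ (φ e) then ⟦ lookup M e ⟧ else 0) ≡ 1
    on-e rewrite dec-true (φ e ≟ φ e) refl | []=⇒lookup e∈M = refl
    off-e : ∀ f → f ≢ e → (if ⁅ φ e ⁆ (φ f) then ⟦ lookup M f ⟧ else 0) ≡ 0
    off-e f f≢e with φ f ≟ φ e | lookup M f in Mf
    ... | yes φf≡φe | true  = contradiction (unique f (lookup⇒[]= f M Mf) φf≡φe) f≢e
    ... | yes _     | false = refl
    ... | no  _     | _     = refl

support : ∀ {k} → (Fin k → ℕ) → Subset k
support g = tabulate (λ e → 0 <ᵇ g e)

module _ {k : ℕ} {g : Fin k → ℕ} where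

  support⁺ : ∀ {e} → 0 < g e → e ∈ₛ support g
  support⁺ {e} 0<ge = lookup⇒[]= e (support g) (trans (lookup∘tabulate _ e) (positive 0<ge))
    where
    positive : ∀ {x} → 0 < x → (0 <ᵇ x) ≡ true
    positive (s≤s _) = refl

  support⁻ : ∀ {e} → e ∈ₛ support g → 0 < g e
  support⁻ {e} e∈ = positive (trans (sym (lookup∘tabulate _ e)) ([]=⇒lookup e∈))
    where
    positive : ∀ {x} → (0 <ᵇ x) ≡ true → 0 < x
    positive {suc _} _ = s≤s z≤n

  module _ {n : ℕ} (φ : Fin k → Fin n) (fibres≡1 : ∀ i → sumOn (⁅ i ⁆ ∘ φ) g ≡ 1) where

    fibres≡1⇒exactlyOnce : ExactlyOnce φ (support g)
    fibres≡1⇒exactlyOnce i with sumOn≡1⇒unique (fibres≡1 i)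
    ... | e , e↦i , 0<ge , unique =
      e , support⁺ 0<ge , ⁅⁆-true e↦i ,
      λ f f∈ φf≡i → unique f (trans (cong ⁅ i ⁆ φf≡i) (dec-true (i ≟ i) refl)) (support⁻ f∈)

    fibres≡1⇒indicator : ∀ e → g e ≡ ⟦ lookup (support g) e ⟧
    fibres≡1⇒indicator e = trans (zero-or-one (g e) ge≤1) (cong ⟦_⟧ (sym (lookup∘tabulate _ e)))
      where
      on-fibre : (g ↾ (⁅ φ e ⁆ ∘ φ)) e ≡ g e
      on-fibre rewrite dec-true (φ e ≟ φ e) refl = refl
      ge≤1 : g e ≤ 1
      ge≤1 = ≤-trans (≤-reflexive (sym on-fibre))
               (≤-trans (term≤sum (g ↾ (⁅ φ e ⁆ ∘ φ)) e) (≤-reflexive (fibres≡1 (φ e))))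
      zero-or-one : ∀ x → x ≤ 1 → x ≡ ⟦ 0 <ᵇ x ⟧
      zero-or-one zero          _ = refl
      zero-or-one (suc zero)    _ = refl
      zero-or-one (suc (suc _)) (s≤s ())

scale-down-≤ : ∀ r {x y F} .{{_ : ℕ.NonZero r}} → r * x ≤ F + r * y → x ≤ F + y
scale-down-≤ r {x} {y} {F} rx≤F+ry with x ≤? y
... | yes x≤y = ≤-trans x≤y (m≤n+m y F)
... | no  x≰y = begin
  x            ≡⟨ m∸n+n≡m y≤x ⟨
  (x ∸ y) + y  ≤⟨ +-monoˡ-≤ y (≤-trans (m≤n*m (x ∸ y) r) r[x∸y]≤F) ⟩
  F + y        ∎
  where
  open ℕ.≤-Reasoning
  y≤x : y ≤ x
  y≤x = ℕ.<⇒≤ (≰⇒> x≰y)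
  r[x∸y]≤F : r * (x ∸ y) ≤ F
  r[x∸y]≤F = +-cancelʳ-≤ (r * y) _ _ (begin
    r * (x ∸ y) + r * y  ≡⟨ ℕ.*-distribˡ-+ r (x ∸ y) y ⟨
    r * ((x ∸ y) + y)    ≡⟨ cong (r *_) (m∸n+n≡m y≤x) ⟩
    r * x                ≤⟨ rx≤F+ry ⟩
    F + r * y            ∎)

module _ {a b : ℕ} (G : BipGraph a b) where

  Regular : ℕ → (Fin (m G) → ℕ) → Set
  Regular r = SupplyDemand.IsFlow G (const r) (const r)

  perfectMatching⇒regular : ∀ {M} → IsPerfectMatching G M → Regular 1 (⟦_⟧ ∘ lookup M)
  perfectMatching⇒regular (tails , heads) =
    exactlyOnce⇒fibres≡1 (tail G) tails , exactlyOnce⇒fibres≡1 (head G) heads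

  regular⇒perfectMatching : ∀ {P} → Regular 1 P →
    IsPerfectMatching G (support P) × (∀ e → P e ≡ ⟦ lookup (support P) e ⟧)
  regular⇒perfectMatching (out≡1 , in≡1) =
    (fibres≡1⇒exactlyOnce (tail G) out≡1 , fibres≡1⇒exactlyOnce (head G) in≡1) ,
    fibres≡1⇒indicator (tail G) out≡1

  den≤matchedEdges : ∀ {M} → IsPerfectMatching G M → ∀ X Y →
                     den G X Y ≤ between G (⟦_⟧ ∘ lookup M) (lookup X) (lookup Y)
  den≤matchedEdges {M} perfect X Y = ℕ.m≤n+o⇒m∸n≤o (∣ X ∣ + ∣ Y ∣) a (begin
    ∣ X ∣ + ∣ Y ∣                                ≡⟨ cong₂ _+_ (∣∣≡sumOn X) (∣∣≡sumOn Y) ⟩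
    sumOn X′ (const 1) + sumOn Y′ (const 1)      ≤⟨ SupplyDemand.flow⇒gale G (const 1) (const 1)
                                                      (perfectMatching⇒regular perfect) X′ Y′ ⟩
    K + sum {a} (const 1)                        ≡⟨ ℕ.+-comm K (sum {a} (const 1)) ⟩
    sum {a} (const 1) + K                        ≡⟨ cong (_+ K) (sum-ones a) ⟩
    a + K                                        ∎)
    where
    open ℕ.≤-Reasoning
    X′ = lookup X
    Y′ = lookup Y
    K = between G (⟦_⟧ ∘ lookup M) X′ Y′

  module _ {r : ℕ} {f : Fin (m G) → ℕ} (regular : Regular (suc r) f) where

    regular-balanced : sum {a} (const 1) ≡ sum {b} (const 1)
    regular-balanced = ℕ.*-cancelˡ-≡ _ _ (suc r) (begin
      suc r * sum {a} (const 1)  ≡⟨ sumOn-const {a} (const true) (suc r) ⟨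
      sum {a} (const (suc r))    ≡⟨ SupplyDemand.flow-balanced G _ _ regular ⟩
      sum {b} (const (suc r))    ≡⟨ sumOn-const {b} (const true) (suc r) ⟩
      suc r * sum {b} (const 1)  ∎)
      where open ≡-Reasoning

    regular⇒gale : SupplyDemand.GaleCondition G (const 1) (const 1) f
    regular⇒gale X Y = scale-down-≤ (suc r) {F = between G f X Y} (begin
      suc r * (sumOn X (const 1) + sumOn Y (const 1))
        ≡⟨ ℕ.*-distribˡ-+ (suc r) (sumOn X (const 1)) (sumOn Y (const 1)) ⟩
      suc r * sumOn X (const 1) + suc r * sumOn Y (const 1)
        ≡⟨ cong₂ _+_ (sumOn-const X (suc r)) (sumOn-const Y (suc r)) ⟨
      sumOn X (const (suc r)) + sumOn Y (const (suc r))
        ≤⟨ SupplyDemand.flow⇒gale G (const (suc r)) (const (suc r)) regular X Y ⟩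
      between G f X Y + sum {a} (const (suc r))
        ≡⟨ cong (between G f X Y +_) (sumOn-const {a} (const true) (suc r)) ⟩
      between G f X Y + suc r * sum {a} (const 1) ∎)
      where open ℕ.≤-Reasoning

    regular⇒1-factor : ∃ λ P → (∀ e → P e ≤ f e) × Regular 1 P
    regular⇒1-factor = Transportation.gale⇒flow G (const 1) (const 1) regular-balanced regular⇒gale

    regular-∸ : {P : Fin (m G) → ℕ} → (∀ e → P e ≤ f e) → Regular 1 P → Regular r (λ e → f e ∸ P e)
    regular-∸ {P} P≤f (P-out , P-in) =
      (λ i → peel (sumOn-∸ (⁅ i ⁆ ∘ tail G) P≤f) (P-out i) (proj₁ regular i)) ,
      (λ j → peel (sumOn-∸ (⁅ j ⁆ ∘ head G) P≤f) (P-in j) (proj₂ regular j))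
      where
      peel : ∀ {x y z} → x + y ≡ z → y ≡ 1 → z ≡ suc r → x ≡ r
      peel {x} refl refl z≡ = ℕ.+-cancelʳ-≡ 1 x r (trans z≡ (ℕ.+-comm 1 r))

fromℕ : ℕ → ℚ
fromℕ n = ℤ.+ n ℚ./ 1

private
  toℚᵘ-/ : ∀ k d .{{_ : ℕ.NonZero d}} → toℚᵘ (ℤ.+ k ℚ./ d) ℚᵘ.≃ mkℚᵘ (ℤ.+ k) (ℕ.pred d)
  toℚᵘ-/ k (suc d) = ℚ.toℚᵘ-fromℚᵘ (mkℚᵘ (ℤ.+ k) d)

/-nonNeg : ∀ k d .{{_ : ℕ.NonZero d}} → 0ℚ ℚ.≤ ℤ.+ k ℚ./ d
/-nonNeg k d = ℚ.nonNegative⁻¹ _ {{ℚ.normalize-nonNeg k d}}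

fromℕ-+ : ∀ m n → fromℕ (m + n) ≡ fromℕ m ℚ.+ fromℕ n
fromℕ-+ m n = ℚ.toℚᵘ-injective (begin
  toℚᵘ (fromℕ (m + n))                ≈⟨ toℚᵘ-/ (m + n) 1 ⟩
  mkℚᵘ (ℤ.+ (m + n)) 0                ≈⟨ *≡* numerators ⟩
  mkℚᵘ (ℤ.+ m) 0 ℚᵘ.+ mkℚᵘ (ℤ.+ n) 0  ≈⟨ ℚᵘ.+-cong (toℚᵘ-/ m 1) (toℚᵘ-/ n 1) ⟨
  toℚᵘ (fromℕ m) ℚᵘ.+ toℚᵘ (fromℕ n)  ≈⟨ ℚ.toℚᵘ-homo-+ (fromℕ m) (fromℕ n) ⟨
  toℚᵘ (fromℕ m ℚ.+ fromℕ n)          ∎)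
  where
  open ℚᵘ.≃-Reasoning
  numerators : ℤ.+ (m + n) ℤ.* ℤ.+ 1 ≡ (ℤ.+ m ℤ.* ℤ.+ 1 ℤ.+ ℤ.+ n ℤ.* ℤ.+ 1) ℤ.* ℤ.+ 1
  numerators = trans (ℤ.*-identityʳ (ℤ.+ (m + n))) (trans (ℤ.pos-+ m n) (sym (trans (ℤ.*-identityʳ _)
    (cong₂ ℤ._+_ (ℤ.*-identityʳ (ℤ.+ m)) (ℤ.*-identityʳ (ℤ.+ n))))))

fromℕ-mono-≤ : ∀ {m n} → m ≤ n → fromℕ m ℚ.≤ fromℕ n
fromℕ-mono-≤ {m} {n} m≤n = begin
  fromℕ m                    ≡⟨ ℚ.+-identityʳ (fromℕ m) ⟨
  fromℕ m ℚ.+ 0ℚ             ≤⟨ ℚ.+-monoʳ-≤ (fromℕ m) (/-nonNeg (n ∸ m) 1) ⟩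
  fromℕ m ℚ.+ fromℕ (n ∸ m)  ≡⟨ fromℕ-+ m (n ∸ m) ⟨
  fromℕ (m + (n ∸ m))        ≡⟨ cong fromℕ (ℕ.m+[n∸m]≡n m≤n) ⟩
  fromℕ n                    ∎
  where open ℚ.≤-Reasoning

fromℕ*1/ : ∀ k d .{{_ : ℕ.NonZero d}} → fromℕ k ℚ.* (ℤ.+ 1 ℚ./ d) ≡ ℤ.+ k ℚ./ d
fromℕ*1/ k d@(suc d-1) = ℚ.toℚᵘ-injective (begin
  toℚᵘ (fromℕ k ℚ.* (ℤ.+ 1 ℚ./ d))        ≈⟨ ℚ.toℚᵘ-homo-* (fromℕ k) (ℤ.+ 1 ℚ./ d) ⟩
  toℚᵘ (fromℕ k) ℚᵘ.* toℚᵘ (ℤ.+ 1 ℚ./ d)  ≈⟨ ℚᵘ.*-cong (toℚᵘ-/ k 1) (toℚᵘ-/ 1 d) ⟩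
  mkℚᵘ (ℤ.+ k) 0 ℚᵘ.* mkℚᵘ (ℤ.+ 1) d-1    ≈⟨ *≡* (ℤ.*-assoc (ℤ.+ k) (ℤ.+ 1) (ℤ.+ d)) ⟩
  mkℚᵘ (ℤ.+ k) d-1                        ≈⟨ toℚᵘ-/ k d ⟨
  toℚᵘ (ℤ.+ k ℚ./ d)                      ∎)
  where open ℚᵘ.≃-Reasoning

n/n≡1 : ∀ d .{{_ : ℕ.NonZero d}} → ℤ.+ d ℚ./ d ≡ 1ℚ
n/n≡1 d@(suc d-1) = ℚ.toℚᵘ-injective (begin
  toℚᵘ (ℤ.+ d ℚ./ d)  ≈⟨ toℚᵘ-/ d d ⟩
  mkℚᵘ (ℤ.+ d) d-1    ≈⟨ *≡* (ℤ.*-comm (ℤ.+ d) (ℤ.+ 1)) ⟩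
  mkℚᵘ (ℤ.+ 1) 0      ≈⟨ toℚᵘ-/ 1 1 ⟨
  toℚᵘ 1ℚ             ∎)
  where open ℚᵘ.≃-Reasoning

/-≤⇒*-≤ : ∀ k d k′ d′ .{{_ : ℕ.NonZero d}} .{{_ : ℕ.NonZero d′}} →
          ℤ.+ k ℚ./ d ℚ.≤ ℤ.+ k′ ℚ./ d′ → k * d′ ≤ k′ * d
/-≤⇒*-≤ k d@(suc _) k′ d′@(suc _) k/d≤k′/d′
  with ℚᵘ.≤-respˡ-≃ (toℚᵘ-/ k d) (ℚᵘ.≤-respʳ-≃ (toℚᵘ-/ k′ d′) (ℚ.toℚᵘ-mono-≤ k/d≤k′/d′))
... | *≤* cross = ℤ.drop‿+≤+ (subst₂ ℤ._≤_ (sym (ℤ.pos-* k d′)) (sym (ℤ.pos-* k′ d)) cross)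

*-≤⇒/-≤ : ∀ p q (x : ℚ) .{{_ : ℕ.NonZero q}} → fromℕ p ℚ.≤ fromℕ q ℚ.* x → ℤ.+ p ℚ./ q ℚ.≤ x
*-≤⇒/-≤ p q@(suc _) x p≤qx = begin
  ℤ.+ p ℚ./ q            ≡⟨ fromℕ*1/ p q ⟨
  fromℕ p ℚ.* u          ≤⟨ ℚ.*-monoʳ-≤-nonNeg u {{ℚ.normalize-nonNeg 1 q}} p≤qx ⟩
  (fromℕ q ℚ.* x) ℚ.* u  ≡⟨ cong (ℚ._* u) (ℚ.*-comm (fromℕ q) x) ⟩
  (x ℚ.* fromℕ q) ℚ.* u  ≡⟨ ℚ.*-assoc x (fromℕ q) u ⟩
  x ℚ.* (fromℕ q ℚ.* u)  ≡⟨ cong (x ℚ.*_) (trans (fromℕ*1/ q q) (n/n≡1 q)) ⟩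
  x ℚ.* 1ℚ               ≡⟨ ℚ.*-identityʳ x ⟩
  x                      ∎
  where
  open ℚ.≤-Reasoning
  u = ℤ.+ 1 ℚ./ q

if-as-product : ∀ b x → (if b then x else 0ℚ) ≡ fromℕ ⟦ b ⟧ ℚ.* x
if-as-product true  x = sym (ℚ.*-identityˡ x)
if-as-product false x = sym (ℚ.*-zeroˡ x)

ΣQ≡sum : (f : Fin n → ℚ) → ΣQ n f ≡ ℚΣ.sum f
ΣQ≡sum {zero}  f = refl
ΣQ≡sum {suc n} f = cong (f zero ℚ.+_) (ΣQ≡sum (f ∘ suc))

ΣQ-cong : {f g : Fin n → ℚ} → (∀ i → f i ≡ g i) → ΣQ n f ≡ ΣQ n g
ΣQ-cong {f = f} {g} f≗g = trans (ΣQ≡sum f) (trans (ℚΣ.sum-cong-≗ f≗g) (sym (ΣQ≡sum g)))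

ΣQ-+ : (f g : Fin n → ℚ) → ΣQ n (λ i → f i ℚ.+ g i) ≡ ΣQ n f ℚ.+ ΣQ n g
ΣQ-+ f g = trans (ΣQ≡sum (λ i → f i ℚ.+ g i))
  (trans (ℚΣ.∑-distrib-+ f g) (sym (cong₂ ℚ._+_ (ΣQ≡sum f) (ΣQ≡sum g))))

ΣQ-*ˡ : (x : ℚ) (f : Fin n → ℚ) → ΣQ n (λ i → x ℚ.* f i) ≡ x ℚ.* ΣQ n f
ΣQ-*ˡ x f = trans (ΣQ≡sum (λ i → x ℚ.* f i))
  (trans (sym (ℚΣ.*-distribˡ-sum x f)) (cong (x ℚ.*_) (sym (ΣQ≡sum f))))

ΣQ-mono-≤ : {f g : Fin n → ℚ} → (∀ i → f i ℚ.≤ g i) → ΣQ n f ℚ.≤ ΣQ n g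
ΣQ-mono-≤ {zero}  f≤g = ℚ.≤-refl
ΣQ-mono-≤ {suc n} f≤g = ℚ.+-mono-≤ (f≤g zero) (ΣQ-mono-≤ (f≤g ∘ suc))

ΣQ-nonNeg : {f : Fin n → ℚ} → (∀ i → 0ℚ ℚ.≤ f i) → 0ℚ ℚ.≤ ΣQ n f
ΣQ-nonNeg {n} {f} 0≤f = subst (ℚ._≤ ΣQ n f) (trans (ΣQ≡sum {n} (const 0ℚ)) (ℚΣ.sum-replicate-zero n))
                          (ΣQ-mono-≤ {f = const 0ℚ} 0≤f)

ΣQ-fromℕ : (g : Fin n → ℕ) → ΣQ n (fromℕ ∘ g) ≡ fromℕ (sum g)
ΣQ-fromℕ {zero}  g = refl
ΣQ-fromℕ {suc n} g = trans (cong (fromℕ (g zero) ℚ.+_) (ΣQ-fromℕ (g ∘ suc))) (sym (fromℕ-+ (g zero) _))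

-- Bounds on fractional matching preclusion

deficiency-bound : ∀ p n x E → (n < x → p * (x ∸ n) ≤ E) → p * x ≤ E + p * n
deficiency-bound p n x E bound with n <? x
... | yes n<x = begin
  p * x                ≡⟨ cong (p *_) (m∸n+n≡m (ℕ.<⇒≤ n<x)) ⟨
  p * ((x ∸ n) + n)    ≡⟨ ℕ.*-distribˡ-+ p (x ∸ n) n ⟩
  p * (x ∸ n) + p * n  ≤⟨ +-monoˡ-≤ (p * n) (bound n<x) ⟩
  E + p * n            ∎
  where open ℕ.≤-Reasoning
... | no  n≮x = ≤-trans (ℕ.*-monoʳ-≤ p (ℕ.≮⇒≥ n≮x)) (m≤n+m (p * n) E)

module _ {a b : ℕ} (G : BipGraph a b) where

  weight : (Fin (m G) → ℕ) → (Fin (m G) → ℚ) → ℚ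
  weight g z = ΣQ (m G) (λ e → fromℕ (g e) ℚ.* z e)

  module _ {z : Fin (m G) → ℚ} where

    weight-cong : {g h : Fin (m G) → ℕ} → (∀ e → g e ≡ h e) → weight g z ≡ weight h z
    weight-cong g≗h = ΣQ-cong (λ e → cong (λ k → fromℕ k ℚ.* z e) (g≗h e))

    weight-+ : (g h : Fin (m G) → ℕ) → weight (λ e → g e + h e) z ≡ weight g z ℚ.+ weight h z
    weight-+ g h = trans (ΣQ-cong (λ e → trans (cong (ℚ._* z e) (fromℕ-+ (g e) (h e)))
                                               (ℚ.*-distribʳ-+ (z e) (fromℕ (g e)) (fromℕ (h e)))))
                         (ΣQ-+ (λ e → fromℕ (g e) ℚ.* z e) (λ e → fromℕ (h e) ℚ.* z e))

    weight-const : (q : ℕ) → weight (const q) z ≡ fromℕ q ℚ.* total G z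
    weight-const q = ΣQ-*ˡ (fromℕ q) z

    matchWeight≡weight : (M : Subset (m G)) → matchWeight G M z ≡ weight (⟦_⟧ ∘ lookup M) z
    matchWeight≡weight M = ΣQ-cong (λ e → if-as-product (lookup M e) (z e))

    module _ (0≤z : ∀ e → 0ℚ ℚ.≤ z e) where

      weight-mono-≤ : {g h : Fin (m G) → ℕ} → (∀ e → g e ≤ h e) → weight g z ℚ.≤ weight h z
      weight-mono-≤ g≤h =
        ΣQ-mono-≤ (λ e → ℚ.*-monoʳ-≤-nonNeg (z e) {{ℚ.nonNegative (0≤z e)}} (fromℕ-mono-≤ (g≤h e)))

      weight-nonNeg : (g : Fin (m G) → ℕ) → 0ℚ ℚ.≤ weight g z
      weight-nonNeg g = ΣQ-nonNeg (λ e → subst (ℚ._≤ fromℕ (g e) ℚ.* z e) (ℚ.*-zeroʳ (fromℕ (g e)))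
        (ℚ.*-monoˡ-≤-nonNeg (fromℕ (g e)) {{ℚ.normalize-nonNeg (g e) 1}} (0≤z e)))

  weight-constʳ : (g : Fin (m G) → ℕ) (u : ℚ) → weight g (const u) ≡ fromℕ (sum g) ℚ.* u
  weight-constʳ g u = begin
    ΣQ (m G) (λ e → fromℕ (g e) ℚ.* u)  ≡⟨ ΣQ-cong (λ e → ℚ.*-comm (fromℕ (g e)) u) ⟩
    ΣQ (m G) (λ e → u ℚ.* fromℕ (g e))  ≡⟨ ΣQ-*ˡ u (fromℕ ∘ g) ⟩
    u ℚ.* ΣQ (m G) (fromℕ ∘ g)          ≡⟨ cong (u ℚ.*_) (ΣQ-fromℕ g) ⟩
    u ℚ.* fromℕ (sum g)                 ≡⟨ ℚ.*-comm u (fromℕ (sum g)) ⟩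
    fromℕ (sum g) ℚ.* u                 ∎
    where open ≡-Reasoning

  regular-bound : ∀ r {f : Fin (m G) → ℕ} {z : Fin (m G) → ℚ} → Regular G r f → Feasible G z →
                  fromℕ r ℚ.≤ weight f z
  regular-bound zero    {f} _ (_ , 0≤z) = weight-nonNeg 0≤z f
  regular-bound (suc r) {f} {z} regular feasible@(matchings≥1 , _) with regular⇒1-factor G regular
  ... | P , P≤f , P-regular with regular⇒perfectMatching G P-regular
  ...   | perfect , P≡𝟙M = begin
    fromℕ (suc r)                                    ≡⟨ fromℕ-+ 1 r ⟩
    1ℚ ℚ.+ fromℕ r                                   ≤⟨ ℚ.+-mono-≤ (matchings≥1 _ perfect) rest ⟩
    matchWeight G (support P) z ℚ.+ weight f∸P z     ≡⟨ cong (ℚ._+ weight f∸P z) P-weight ⟩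
    weight P z ℚ.+ weight f∸P z                      ≡⟨ weight-+ P f∸P ⟨
    weight (λ e → P e + f∸P e) z                     ≡⟨ weight-cong (λ e → ℕ.m+[n∸m]≡n (P≤f e)) ⟩
    weight f z                                       ∎
    where
    open ℚ.≤-Reasoning
    f∸P : Fin (m G) → ℕ
    f∸P e = f e ∸ P e
    rest : fromℕ r ℚ.≤ weight f∸P z
    rest = regular-bound r (regular-∸ G regular P≤f P-regular) feasible
    P-weight : matchWeight G (support P) z ≡ weight P z
    P-weight = trans (matchWeight≡weight (support P)) (sym (weight-cong P≡𝟙M))

  eXY≡between : (X : Subset a) (Y : Subset b) → eXY G X Y ≡ between G (const 1) (lookup X) (lookup Y)
  eXY≡between X Y = count≡sumOn (m G) _

  eXY-tabulate : (X : Fin a → Bool) (Y : Fin b → Bool) →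
                 eXY G (tabulate X) (tabulate Y) ≡ between G (const 1) X Y
  eXY-tabulate X Y = trans (eXY≡between (tabulate X) (tabulate Y))
    (sumOn-congˡ (λ e → cong₂ _∧_ (lookup∘tabulate X (tail G e)) (lookup∘tabulate Y (head G e))))

  RatioBound : ℕ → ℕ → Set
  RatioBound p q = ∀ X Y (valid : a < ∣ X ∣ + ∣ Y ∣) → p * den G X Y ≤ eXY G X Y * q

  BelowAllRatios : ℚ → Set
  BelowAllRatios v = ∀ X Y (valid : a < ∣ X ∣ + ∣ Y ∣) → v ℚ.≤ ratio G X Y valid

  minimal⇒ratioBound : ∀ X Y (valid : a < ∣ X ∣ + ∣ Y ∣) → BelowAllRatios (ratio G X Y valid) →
                       RatioBound (eXY G X Y) (den G X Y)
  minimal⇒ratioBound X Y valid minimal X′ Y′ valid′ =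
    /-≤⇒*-≤ (eXY G X Y) (den G X Y) (eXY G X′ Y′) (den G X′ Y′)
      {{ℕ.>-nonZero (ℕ.m<n⇒0<n∸m valid)}} {{ℕ.>-nonZero (ℕ.m<n⇒0<n∸m valid′)}}
      (minimal X′ Y′ valid′)

  ratioBound⇒balanced : a ≤ b → ∀ {p q} → 0 < p → RatioBound p q → a ≡ b
  ratioBound⇒balanced a≤b {suc p} {q} _ bound with a <? b
  ... | no  a≮b = ≤-antisym a≤b (ℕ.≮⇒≥ a≮b)
  ... | yes a<b =
    contradiction (≤-trans positive (≤-trans (bound ⊥ ⊤ valid) (≤-reflexive no-edges))) λ ()
    where
    valid : a < ∣ ⊥ {a} ∣ + ∣ ⊤ {b} ∣
    valid = subst (a <_) (sym (cong₂ _+_ (∣⊥∣≡0 a) (∣⊤∣≡n b))) a<b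
    positive : 1 ≤ suc p * den G ⊥ ⊤
    positive = ≤-trans (ℕ.m<n⇒0<n∸m valid) (m≤n*m _ (suc p))
    no-edges : eXY G ⊥ ⊤ * q ≡ 0
    no-edges = cong (_* q) (trans (eXY≡between ⊥ ⊤)
      (trans (sumOn-congˡ {Q = const false} ⊥-tail) (sumOn-none {n = m G} {g = const 1})))
      where
      ⊥-tail : ∀ e → lookup ⊥ (tail G e) ∧ lookup ⊤ (head G e) ≡ false
      ⊥-tail e = cong (_∧ lookup ⊤ (head G e)) (lookup-replicate (tail G e) false)

  ratioBound⇒gale : ∀ {p q} → RatioBound p q → SupplyDemand.GaleCondition G (const p) (const p) (const q)
  ratioBound⇒gale {p} {q} bound X Y = begin
    sumOn X (const p) + sumOn Y (const p)          ≡⟨ cong₂ _+_ (sumOn-const X p) (sumOn-const Y p) ⟩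
    p * sumOn X (const 1) + p * sumOn Y (const 1)  ≡⟨ ℕ.*-distribˡ-+ p _ _ ⟨
    p * (sumOn X (const 1) + sumOn Y (const 1))    ≤⟨ deficiency-bound p a _ _ from-ratio ⟩
    q * between G (const 1) X Y + p * a            ≡⟨ cong₂ _+_ (sumOn-const X×Y q)
                                                       (trans (sumOn-const {a} (const true) p) (cong (p *_) (sum-ones a))) ⟨
    between G (const q) X Y + sum {a} (const p)    ∎
    where
    open ℕ.≤-Reasoning
    X×Y : Fin (m G) → Bool
    X×Y e = X (tail G e) ∧ Y (head G e)
    sizes : ∣ tabulate X ∣ + ∣ tabulate Y ∣ ≡ sumOn X (const 1) + sumOn Y (const 1)
    sizes = cong₂ _+_ (∣tabulate∣ X) (∣tabulate∣ Y)
    from-ratio : a < sumOn X (const 1) + sumOn Y (const 1) →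
                 p * (sumOn X (const 1) + sumOn Y (const 1) ∸ a) ≤ q * between G (const 1) X Y
    from-ratio valid = subst₂ _≤_ (cong (λ k → p * (k ∸ a)) sizes)
      (trans (cong (_* q) (eXY-tabulate X Y)) (ℕ.*-comm _ q))
      (bound (tabulate X) (tabulate Y) (subst (a <_) (sym sizes) valid))

  ratioBound⇒lowerBound : a ≤ b → ∀ p q .{{_ : ℕ.NonZero q}} → RatioBound p q →
                          ∀ {z} → Feasible G z → ℤ.+ p ℚ./ q ℚ.≤ total G z
  ratioBound⇒lowerBound a≤b zero q _ {z} (_ , 0≤z) =
    subst (ℚ._≤ total G z) (sym (ℚ.0/n≡0 q)) (ΣQ-nonNeg {f = z} 0≤z)
  ratioBound⇒lowerBound a≤b p@(suc _) q bound {z} feasible@(_ , 0≤z)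
    with Transportation.gale⇒flow G (const p) (const p) balanced (ratioBound⇒gale bound)
    where
    balanced : sum {a} (const p) ≡ sum {b} (const p)
    balanced = cong (λ n → sum {n} (const p)) (ratioBound⇒balanced a≤b {p} {q} (s≤s z≤n) bound)
  ... | f , f≤q , regular = *-≤⇒/-≤ p q (total G z) (begin
    fromℕ p                ≤⟨ regular-bound p regular feasible ⟩
    weight f z             ≤⟨ weight-mono-≤ 0≤z f≤q ⟩
    weight (const q) z     ≡⟨ weight-const q ⟩
    fromℕ q ℚ.* total G z  ∎)
    where open ℚ.≤-Reasoning

module _ {a b : ℕ} (G : BipGraph a b) (X : Subset a) (Y : Subset b) (valid : a < ∣ X ∣ + ∣ Y ∣) where

  private
    instance
      den≢0 : ℕ.NonZero (den G X Y)
      den≢0 = ℕ.>-nonZero (ℕ.m<n⇒0<n∸m valid)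
    d = den G X Y
    u = ℤ.+ 1 ℚ./ d
    inXY : Fin (m G) → Bool
    inXY e = lookup X (tail G e) ∧ lookup Y (head G e)

  ytilde-total : total G (ytilde G X Y valid) ≡ ratio G X Y valid
  ytilde-total = begin
    total G (ytilde G X Y valid)      ≡⟨ ΣQ-cong (λ e → if-as-product (inXY e) u) ⟩
    weight G (⟦_⟧ ∘ inXY) (const u)   ≡⟨ weight-constʳ G (⟦_⟧ ∘ inXY) u ⟩
    fromℕ (sum (⟦_⟧ ∘ inXY)) ℚ.* u    ≡⟨ cong (λ k → fromℕ k ℚ.* u) (count≡sumOn (m G) inXY) ⟨
    fromℕ (eXY G X Y) ℚ.* u           ≡⟨ fromℕ*1/ (eXY G X Y) d ⟩
    ratio G X Y valid                 ∎
    where open ≡-Reasoning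

  ytilde-feasible : Feasible G (ytilde G X Y valid)
  ytilde-feasible = covers-matchings , nonNeg
    where
    nonNeg : ∀ e → 0ℚ ℚ.≤ ytilde G X Y valid e
    nonNeg e with inXY e
    ... | true  = /-nonNeg 1 d
    ... | false = ℚ.≤-refl
    restrict : ∀ c x → fromℕ x ℚ.* (if c then u else 0ℚ) ≡ fromℕ (if c then x else 0) ℚ.* u
    restrict true  x = refl
    restrict false x = trans (ℚ.*-zeroʳ (fromℕ x)) (sym (ℚ.*-zeroˡ u))
    covers-matchings : ∀ M → IsPerfectMatching G M → 1ℚ ℚ.≤ matchWeight G M (ytilde G X Y valid)
    covers-matchings M perfect = begin
      1ℚ                                              ≡⟨ trans (fromℕ*1/ d d) (n/n≡1 d) ⟨
      fromℕ d ℚ.* u                                 ≤⟨ ℚ.*-monoʳ-≤-nonNeg u {{ℚ.normalize-nonNeg 1 d}}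
                                                         (fromℕ-mono-≤ (den≤matchedEdges G perfect X Y)) ⟩
      fromℕ (sumOn inXY 𝟙M) ℚ.* u                   ≡⟨ weight-constʳ G (𝟙M ↾ inXY) u ⟨
      weight G (𝟙M ↾ inXY) (const u)                ≡⟨ ΣQ-cong (λ e → restrict (inXY e) (𝟙M e)) ⟨
      weight G 𝟙M (ytilde G X Y valid)              ≡⟨ matchWeight≡weight G M ⟨
      matchWeight G M (ytilde G X Y valid)          ∎
      where
      open ℚ.≤-Reasoning
      𝟙M : Fin (m G) → ℕ
      𝟙M = ⟦_⟧ ∘ lookup M

-- The least ratio

subsets : ∀ n → List (Subset n)
subsets zero    = [] ∷ []
subsets (suc n) = List.map (true ∷_) (subsets n) ++ List.map (false ∷_) (subsets n)

∈-subsets : (X : Subset n) → X ∈ subsets n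
∈-subsets []          = here refl
∈-subsets (true ∷ X)  = ∈-++⁺ˡ (∈-map⁺ (true ∷_) (∈-subsets X))
∈-subsets (false ∷ X) = ∈-++⁺ʳ (List.map (true ∷_) (subsets _)) (∈-map⁺ (false ∷_) (∈-subsets X))

module _ {A : Set} {P : A → Set} (P? : Decidable P) (P-irrelevant : ∀ {x} → Irrelevant (P x))
         (f : ∀ x → P x → ℚ) where

  MinimumOn : List A → Set
  MinimumOn xs = ∃ λ x → Σ (P x) λ px → ∀ y (py : P y) → y ∈ xs → f x px ℚ.≤ f y py

  minimumOn : (xs : List A) → MinimumOn xs ⊎ (∀ y → y ∈ xs → ¬ P y)
  minimumOn [] = inj₂ (λ _ ())
  minimumOn (x ∷ xs) with minimumOn xs | P? x
  ... | inj₂ none | no ¬px = inj₂ λ where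
    _ (here refl)   → ¬px
    y (there y∈xs) → none y y∈xs
  ... | inj₂ none | yes px = inj₁ (x , px , λ where
    _ py (here refl)   → ℚ.≤-reflexive (cong (f x) (P-irrelevant px py))
    y py (there y∈xs) → contradiction py (none y y∈xs))
  ... | inj₁ (x′ , px′ , minimal) | no ¬px = inj₁ (x′ , px′ , λ where
    _ py (here refl)   → contradiction py ¬px
    y py (there y∈xs) → minimal y py y∈xs)
  ... | inj₁ (x′ , px′ , minimal) | yes px with ℚ.≤-total (f x px) (f x′ px′)
  ...   | inj₁ fx≤fx′ = inj₁ (x , px , λ where
    _ py (here refl)   → ℚ.≤-reflexive (cong (f x) (P-irrelevant px py))
    y py (there y∈xs) → ℚ.≤-trans fx≤fx′ (minimal y py y∈xs))
  ...   | inj₂ fx′≤fx = inj₁ (x′ , px′ , λ where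
    _ py (here refl)   → ℚ.≤-trans fx′≤fx (ℚ.≤-reflexive (cong (f x) (P-irrelevant px py)))
    y py (there y∈xs) → minimal y py y∈xs)

leastRatio : ∀ {a b} (G : BipGraph a b) → 0 < b →
             ∃₂ λ X Y → Σ (a < ∣ X ∣ + ∣ Y ∣) λ valid → BelowAllRatios G (ratio G X Y valid)
leastRatio {a} {b} G 0<b = [ found , ⊥-elim ∘ none-valid ]′ (minimumOn valid? ℕ.<-irrelevant ratio′ pairs)
  where
  Valid : Subset a × Subset b → Set
  Valid (X , Y) = a < ∣ X ∣ + ∣ Y ∣
  valid? : Decidable Valid
  valid? (X , Y) = a <? ∣ X ∣ + ∣ Y ∣
  ratio′ : ∀ XY → Valid XY → ℚ
  ratio′ (X , Y) = ratio G X Y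
  pairs : List (Subset a × Subset b)
  pairs = cartesianProduct (subsets a) (subsets b)
  ∈-pairs : ∀ X Y → (X , Y) ∈ pairs
  ∈-pairs X Y = ∈-cartesianProduct⁺ (∈-subsets X) (∈-subsets Y)
  found : MinimumOn valid? ℕ.<-irrelevant ratio′ pairs →
          ∃₂ λ X Y → Σ (a < ∣ X ∣ + ∣ Y ∣) λ valid → BelowAllRatios G (ratio G X Y valid)
  found ((X , Y) , valid , minimal) =
    X , Y , valid , λ X′ Y′ valid′ → minimal (X′ , Y′) valid′ (∈-pairs X′ Y′)
  none-valid : ¬ (∀ XY → XY ∈ pairs → ¬ Valid XY)
  none-valid none = none (⊤ , ⊤) (∈-pairs ⊤ ⊤) (subst (a <_) (sym (cong₂ _+_ (∣⊤∣≡n a) (∣⊤∣≡n b)))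
                                                   (subst (_< a + b) (ℕ.+-identityʳ a) (ℕ.+-monoʳ-< a 0<b)))

leastRatio⇒mpf : ∀ {a b} (G : BipGraph a b) → a ≤ b → ∀ X Y (valid : a < ∣ X ∣ + ∣ Y ∣) →
                 BelowAllRatios G (ratio G X Y valid) → IsMpf G (ratio G X Y valid)
leastRatio⇒mpf G a≤b X Y valid least =
  ytilde G X Y valid , (ytilde-feasible G X Y valid , optimal) , ytilde-total G X Y valid
  where
  optimal : ∀ z → Feasible G z → total G (ytilde G X Y valid) ℚ.≤ total G z
  optimal z feasible = subst (ℚ._≤ total G z) (sym (ytilde-total G X Y valid))
    (ratioBound⇒lowerBound G a≤b (eXY G X Y) (den G X Y) {{ℕ.>-nonZero (ℕ.m<n⇒0<n∸m valid)}}
      (minimal⇒ratioBound G X Y valid least) feasible)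

theorem3p6 : ∀ {a b : ℕ} (G : BipGraph a b) → a ≤ b →
    (0 < b → Σ ℚ λ v → IsMpf G v × IsMinRatio G v)
    × (∀ (X : Subset a) (Y : Subset b) (p : a < ∣ X ∣ + ∣ Y ∣) →
         IsMpf G (ratio G X Y p) → IsOptimalSolution G (ytilde G X Y p))
theorem3p6 {a} {b} G a≤b = least-ratio-is-mpf , minimizer-is-optimal
  where
  least-ratio-is-mpf : 0 < b → Σ ℚ λ v → IsMpf G v × IsMinRatio G v
  least-ratio-is-mpf 0<b =
    let X , Y , valid , least = leastRatio G 0<b
    in ratio G X Y valid , leastRatio⇒mpf G a≤b X Y valid least , (X , Y , valid , refl) , least

  minimizer-is-optimal : ∀ X Y (valid : a < ∣ X ∣ + ∣ Y ∣) →
                         IsMpf G (ratio G X Y valid) → IsOptimalSolution G (ytilde G X Y valid)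
  minimizer-is-optimal X Y valid (y , (_ , y-optimal) , total-y≡ratio) =
    ytilde-feasible G X Y valid ,
    λ z feasible → subst (ℚ._≤ total G z) (trans total-y≡ratio (sym (ytilde-total G X Y valid)))
                         (y-optimal z feasible)
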